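{- Let $H$ be a graph on vertex set $[k]$. Let $W$ be the lexicographically first minimum vertex cover of $H$; let $U_1$ be the lexicographically first among the inclusion-maximal sets $U\subseteq[k]\setminus W$ for which $H$ contains a matching from $U$ to $W$ of size $|U|$; and let $U_2$ be the lexicographically first among the inclusion-maximal sets $U\subseteq[k]\setminus(W\cup U_1)$ for which $H$ contains a matching from $U$ to $W$ of size $|U|$. Then every minimum vertex cover of $H[W\cup U_1\cup U_2]$ is also a vertex cover of $H$.
   Context: For $S\subseteq[k]$, $H[S]$ is the subgraph of $H$ whose edges are those of $H$ with both endpoints in $S$. Lexicographic order on subsets of $[k]$: a set $U$ is lexicographically smaller than a set $V\ne U$ if the smallest element of the symmetric difference of $U$ and $V$ lies in $U$. -}

module Defs where

open import Data.Nat using (ℕ; _≤_)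
open import Data.Fin using (Fin; _<_)
open import Data.Fin.Subset using (Subset; _∈_; _∉_; _⊆_; ∁; _∪_; ∣_∣)
open import Data.Product using (Σ; _×_; ∃)
open import Data.Sum using (_⊎_)
open import Relation.Nullary using (¬_; Dec)
open import Relation.Binary.PropositionalEquality using (_≡_)
open import Function.Bundles using (_⇔_)

record Graph (k : ℕ) : Set₁ where
  field
    Adj    : Fin k → Fin k → Set
    sym    : ∀ {i j} → Adj i j → Adj j i
    irrefl : ∀ {i} → ¬ Adj i i
    dec    : ∀ i j → Dec (Adj i j)
open Graph public

induced : ∀ {k} → Graph k → Subset k → Graph k
induced H S = record
  { Adj = λ i j → Adj H i j × i ∈ S × j ∈ S
  ; sym = λ { (a , p , q) → sym H a , q , p }
  ; irrefl = λ { (a , _ , _) → irrefl H a }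
  ; dec = decAdj }
  where
  open import Data.Product using (_,_)
  open import Relation.Nullary.Decidable using (_×-dec_)
  open import Data.Fin.Subset.Properties using (_∈?_)
  decAdj : ∀ i j → Dec (Adj H i j × i ∈ S × j ∈ S)
  decAdj i j = dec H i j ×-dec ((i ∈? S) ×-dec (j ∈? S))

IsVertexCover : ∀ {k} → Graph k → Subset k → Set
IsVertexCover H C = ∀ i j → Adj H i j → i ∈ C ⊎ j ∈ C

IsMinVertexCover : ∀ {k} → Graph k → Subset k → Set
IsMinVertexCover H C =
  IsVertexCover H C × (∀ D → IsVertexCover H D → ∣ C ∣ ≤ ∣ D ∣)

_<lex_ : ∀ {k} → Subset k → Subset k → Set
U <lex V = ∃ λ i → i ∈ U × i ∉ V × (∀ j → j < i → (j ∈ U ⇔ j ∈ V))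

IsLexFirst : ∀ {k} → (Subset k → Set) → Subset k → Set
IsLexFirst P U = P U × (∀ V → P V → U ≡ V ⊎ U <lex V)

IsInclMaximal : ∀ {k} → (Subset k → Set) → Subset k → Set
IsInclMaximal P U = P U × (∀ V → P V → U ⊆ V → V ⊆ U)

HasMatchingInto : ∀ {k} → Graph k → Subset k → Subset k → Set
HasMatchingInto {k} H U W =
  Σ (Fin k → Fin k) λ f →
    (∀ i → i ∈ U → f i ∈ W × Adj H i (f i)) ×
    (∀ i j → i ∈ U → j ∈ U → f i ≡ f j → i ≡ j)

Candidate : ∀ {k} → Graph k → Subset k → Subset k → Subset k → Set
Candidate H W X U = U ⊆ ∁ X × HasMatchingInto H U W

{-# OPTIONS --safe #-}
-- Let S = W ∪ U₁ ∪ U₂.  An edge of H missed by C has an endpoint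
-- a ∈ W ∖ C, and, as C covers H[S], its other endpoint v lies outside S.  By maximality U₁ + v
-- cannot be matched into W, so the augmenting-path search from v fails and leaves a set
-- Q₁ ⊆ f₁(U₁) containing a and closed under f₁-alternating steps; likewise Q₂ for U₂.  Swapping
-- the f-preimage of such a Q for Q itself keeps a cover of H[S] without making it larger.
-- Swapping along Q₁ puts a into the cover; after that the f₂-partner of a is redundant, so
-- swapping along Q₂ gives a strictly smaller cover of H[S], contradicting the minimality of C.
module Submission where

open import Defs
open import Data.Nat using (ℕ)
open import Data.Fin.Subset using (Subset; _∪_)

open import Data.Fin using (Fin; zero; suc; _≟_)
open import Data.Fin.Properties using (any?)
open import Data.Fin.Subset using (_∈_; _∉_; _⊆_; ∁; ∣_∣; _∩_; _─_; _-_; ⁅_⁆; ⊥; inside; outside)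
open import Data.Fin.Subset.Properties
open import Data.Nat using (zero; suc; _≤_; _<_; z≤n; s≤s)
open import Data.Nat.Properties
  using (≤-refl; ≤-trans; ≤-reflexive; ≤-pred; ≤-<-trans; <-≤-trans; <⇒≱; module ≤-Reasoning)
open import Data.Product using (∃; _×_; _,_; proj₁; proj₂)
import Data.Product as Product
open import Data.Sum using (_⊎_; inj₁; inj₂; [_,_]′; swap)
import Data.Sum as Sum
open import Data.Vec using (_∷_; tabulate; lookup; there)
open import Data.Vec.Properties using (lookup∘tabulate; []=⇒lookup; lookup⇒[]=)
open import Data.Vec.Functional using (updateAt)
open import Data.Vec.Functional.Properties using (updateAt-updates; updateAt-minimal)
open import Function using (_∘_; id; const)
open import Relation.Nullary using (¬_; yes; no; contradiction)
open import Relation.Nullary.Decidable using (_×-dec_; decidable-stable)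
open import Relation.Binary.PropositionalEquality
  using (_≡_; _≢_; refl; trans; cong) renaming (sym to ≡-sym)

private variable
  k m n : ℕ
  x y : Fin k
  p q : Subset k

x∈p─q⇒x∉q : ∀ (p q : Subset n) → x ∈ p ─ q → x ∉ q
x∈p─q⇒x∉q {x = zero}  (_ ∷ p) (inside  ∷ q) ()
x∈p─q⇒x∉q {x = zero}  (_ ∷ p) (outside ∷ q) _ = λ ()
x∈p─q⇒x∉q {x = suc x} (_ ∷ p) (_       ∷ q) (there x∈p─q) (there x∈q) = x∈p─q⇒x∉q p q x∈p─q x∈q

x∈p-y⇒x∈p : x ∈ p - y → x ∈ p
x∈p-y⇒x∈p {p = p} {y} = p─q⊆p p ⁅ y ⁆

x∈p-y⇒x≢y : x ∈ p - y → x ≢ y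
x∈p-y⇒x≢y {p = p} {y} x∈p-y refl = x∈p─q⇒x∉q p ⁅ y ⁆ x∈p-y (x∈⁅x⁆ y)

x∈p∪⁅y⁆∧x≢y⇒x∈p : x ∈ p ∪ ⁅ y ⁆ → x ≢ y → x ∈ p
x∈p∪⁅y⁆∧x≢y⇒x∈p {p = p} {y} x∈ x≢y with x∈p∪q⁻ p ⁅ y ⁆ x∈
... | inj₁ x∈p = x∈p
... | inj₂ x∈⁅y⁆ = contradiction (x∈⁅y⁆⇒x≡y y x∈⁅y⁆) x≢y

p⊆p-x∪⁅x⁆ : p ⊆ (p - x) ∪ ⁅ x ⁆
p⊆p-x∪⁅x⁆ {x = x} {y} y∈p with y ≟ x
... | yes refl = x∈p∪q⁺ (inj₂ (x∈⁅x⁆ x))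
... | no y≢x   = x∈p∪q⁺ (inj₁ (x∈p∧x≢y⇒x∈p-y y∈p y≢x))

x∈p⇒∣p∣≡1+∣p-x∣ : ∀ (p : Subset n) → x ∈ p → ∣ p ∣ ≡ suc ∣ p - x ∣
x∈p⇒∣p∣≡1+∣p-x∣ {x = zero} (inside  ∷ p)  here        = cong (suc ∘ ∣_∣) (≡-sym (p─⊥≡p p))
x∈p⇒∣p∣≡1+∣p-x∣ {x = suc x} (inside  ∷ p) (there x∈p) = cong suc (x∈p⇒∣p∣≡1+∣p-x∣ p x∈p)
x∈p⇒∣p∣≡1+∣p-x∣ {x = suc x} (outside ∷ p) (there x∈p) = x∈p⇒∣p∣≡1+∣p-x∣ p x∈p

preimage : (Fin m → Fin n) → Subset n → Subset m
preimage f q = tabulate (lookup q ∘ f)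

x∈preimage⁺ : ∀ {f : Fin m → Fin n} → f x ∈ q → x ∈ preimage f q
x∈preimage⁺ {x = x} {q = q} {f} fx∈q =
  lookup⇒[]= x _ (trans (lookup∘tabulate (lookup q ∘ f) x) ([]=⇒lookup fx∈q))

x∈preimage⁻ : ∀ {f : Fin m → Fin n} → x ∈ preimage f q → f x ∈ q
x∈preimage⁻ {x = x} {q = q} {f} x∈ =
  lookup⇒[]= (f x) q (trans (≡-sym (lookup∘tabulate (lookup q ∘ f) x)) ([]=⇒lookup x∈))

⋃ᵢ : (Fin n → Subset k) → Subset k
⋃ᵢ {zero}  _  = ⊥
⋃ᵢ {suc n} ps = ps zero ∪ ⋃ᵢ (ps ∘ suc)

x∈⋃ᵢ⁺ : ∀ (ps : Fin n → Subset k) i → x ∈ ps i → x ∈ ⋃ᵢ ps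
x∈⋃ᵢ⁺ ps zero    x∈ = x∈p∪q⁺ (inj₁ x∈)
x∈⋃ᵢ⁺ ps (suc i) x∈ = x∈p∪q⁺ (inj₂ (x∈⋃ᵢ⁺ (ps ∘ suc) i x∈))

x∈⋃ᵢ⁻ : ∀ (ps : Fin n → Subset k) → x ∈ ⋃ᵢ ps → ∃ λ i → x ∈ ps i
x∈⋃ᵢ⁻ {zero}  ps x∈ = contradiction x∈ ∉⊥
x∈⋃ᵢ⁻ {suc n} ps x∈ with x∈p∪q⁻ (ps zero) (⋃ᵢ (ps ∘ suc)) x∈
... | inj₁ x∈p = zero , x∈p
... | inj₂ x∈⋃ = Product.map suc id (x∈⋃ᵢ⁻ (ps ∘ suc) x∈⋃)

∀⊎⇒⊎∀ : ∀ {A : Set} {B : Fin n → Set} → (∀ i → A ⊎ B i) → A ⊎ (∀ i → B i)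
∀⊎⇒⊎∀ {zero}  _ = inj₂ λ ()
∀⊎⇒⊎∀ {suc n} h with h zero | ∀⊎⇒⊎∀ (h ∘ suc)
... | inj₁ a | _       = inj₁ a
... | inj₂ _ | inj₁ a  = inj₁ a
... | inj₂ b | inj₂ bs = inj₂ λ { zero → b ; (suc i) → bs i }

Injects : (Fin k → Fin k → Set) → Subset k → Subset k → Set
Injects R p q =
  (∀ {x} → x ∈ p → ∃ λ y → y ∈ q × R x y) ×
  (∀ {x x′ y} → x ∈ p → x′ ∈ p → R x y → R x′ y → x ≡ x′)

module _ {R : Fin k → Fin k → Set} where

  injects-remove : Injects R p q → x ∈ p → R x y → Injects R (p - x) (q - y)
  injects-remove {p = p} {q} {x} {y} (total , injective) x∈p Rxy =
    total′ , λ z∈ z′∈ → injective (x∈p-y⇒x∈p z∈) (x∈p-y⇒x∈p z′∈)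
    where
    total′ : ∀ {z} → z ∈ p - x → ∃ λ y′ → y′ ∈ q - y × R z y′
    total′ z∈p-x with total (x∈p-y⇒x∈p z∈p-x)
    ... | y′ , y′∈q , Rzy′ = y′ , x∈p∧x≢y⇒x∈p-y y′∈q y′≢y , Rzy′
      where
      y′≢y : y′ ≢ y
      y′≢y refl = x∈p-y⇒x≢y z∈p-x (injective (x∈p-y⇒x∈p z∈p-x) x∈p Rzy′ Rxy)

  injects⇒∣p∣≤∣q∣ : Injects R p q → ∣ p ∣ ≤ ∣ q ∣
  injects⇒∣p∣≤∣q∣ {p = p} = bounded ∣ p ∣ ≤-refl
    where
    bounded : ∀ n {p q} → ∣ p ∣ ≤ n → Injects R p q → ∣ p ∣ ≤ ∣ q ∣
    bounded zero    ∣p∣≤0 _ = ≤-trans ∣p∣≤0 z≤n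
    bounded (suc n) {p} {q} ∣p∣≤1+n inj with nonempty? p
    ... | no  p-empty =
      ≤-trans (≤-reflexive (trans (cong ∣_∣ (Empty-unique p-empty)) (∣⊥∣≡0 k))) z≤n
    ... | yes (x , x∈p) with proj₁ inj x∈p
    ...   | y , y∈q , Rxy = begin
      ∣ p ∣          ≡⟨ x∈p⇒∣p∣≡1+∣p-x∣ p x∈p ⟩
      suc ∣ p - x ∣  ≤⟨ s≤s (bounded n ∣p-x∣≤n (injects-remove inj x∈p Rxy)) ⟩
      suc ∣ q - y ∣  ≤⟨ x∈p⇒∣p-x∣<∣p∣ y∈q ⟩
      ∣ q ∣          ∎
      where
      open ≤-Reasoning
      ∣p-x∣≤n : ∣ p - x ∣ ≤ n
      ∣p-x∣≤n = ≤-pred (<-≤-trans (x∈p⇒∣p-x∣<∣p∣ x∈p) ∣p∣≤1+n)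

  injects-avoiding⇒∣p∣<∣q∣ : Injects R p q → y ∈ q → (∀ {x} → x ∈ p → ¬ R x y) → ∣ p ∣ < ∣ q ∣
  injects-avoiding⇒∣p∣<∣q∣ {p = p} {q} {y} (total , injective) y∈q avoids =
    ≤-<-trans (injects⇒∣p∣≤∣q∣ (total′ , injective)) (x∈p⇒∣p-x∣<∣p∣ y∈q)
    where
    total′ : ∀ {x} → x ∈ p → ∃ λ y′ → y′ ∈ q - y × R x y′
    total′ x∈p with total x∈p
    ... | y′ , y′∈q , Rxy′ = y′ , x∈p∧x≢y⇒x∈p-y y′∈q (λ { refl → avoids x∈p Rxy′ }) , Rxy′

IsMatching : Graph k → Subset k → Subset k → (Fin k → Fin k) → Set
IsMatching H U W f =
  (∀ i → i ∈ U → f i ∈ W × Adj H i (f i)) ×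
  (∀ i j → i ∈ U → j ∈ U → f i ≡ f j → i ≡ j)

module _ (H : Graph k) where

  private variable
    U U′ W : Subset k
    f g : Fin k → Fin k
    u w : Fin k

  matching-⊆ : U ⊆ U′ → IsMatching H U′ W f → IsMatching H U W f
  matching-⊆ U⊆U′ (maps , injective) =
    (λ i → maps i ∘ U⊆U′) , λ i j i∈U j∈U → injective i j (U⊆U′ i∈U) (U⊆U′ j∈U)

  matching-avoid : IsMatching H U W f → (∀ u → u ∈ U → f u ≢ w) → IsMatching H U (W - w) f
  matching-avoid {U = U} {W} {f} {w} (maps , injective) avoids = maps′ , injective
    where
    maps′ : ∀ i → i ∈ U → f i ∈ W - w × Adj H i (f i)
    maps′ i i∈U = Product.map₁ (λ fi∈W → x∈p∧x≢y⇒x∈p-y fi∈W (avoids i i∈U)) (maps i i∈U)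

  matching-remove : IsMatching H U W f → u ∈ U → IsMatching H (U - u) (W - f u) f
  matching-remove {U = U} matching@(_ , injective) u∈U =
    matching-avoid (matching-⊆ (p─q⊆p U _) matching)
      λ i i∈U-u fi≡fu → x∈p-y⇒x≢y i∈U-u (injective i _ (x∈p-y⇒x∈p i∈U-u) u∈U fi≡fu)

  matching-extend : IsMatching H U (W - w) g → w ∈ W → Adj H y w →
                    IsMatching H (U ∪ ⁅ y ⁆) W (updateAt g y (const w))
  matching-extend {U = U} {W} {w} {g} {y} (maps , injective) w∈W y~w = maps′ , injective′
    where
    g′ : Fin k → Fin k
    g′ = updateAt g y (const w)

    g′y≡w : g′ y ≡ w
    g′y≡w = updateAt-updates y g

    g′≡g : ∀ {i} → i ≢ y → g′ i ≡ g i
    g′≡g i≢y = updateAt-minimal _ y g i≢y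

    old : ∀ {i} → i ∈ U ∪ ⁅ y ⁆ → i ≢ y → i ∈ U
    old = x∈p∪⁅y⁆∧x≢y⇒x∈p

    g′-fresh : ∀ {i} → i ∈ U ∪ ⁅ y ⁆ → i ≢ y → g′ i ≢ g′ y
    g′-fresh i∈ i≢y g′i≡g′y =
      x∈p-y⇒x≢y (proj₁ (maps _ (old i∈ i≢y))) (trans (≡-sym (g′≡g i≢y)) (trans g′i≡g′y g′y≡w))

    maps′ : ∀ i → i ∈ U ∪ ⁅ y ⁆ → g′ i ∈ W × Adj H i (g′ i)
    maps′ i i∈ with i ≟ y
    ... | yes refl rewrite g′y≡w    = w∈W , y~w
    ... | no  i≢y  rewrite g′≡g i≢y = Product.map₁ x∈p-y⇒x∈p (maps i (old i∈ i≢y))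

    injective′ : ∀ i j → i ∈ U ∪ ⁅ y ⁆ → j ∈ U ∪ ⁅ y ⁆ → g′ i ≡ g′ j → i ≡ j
    injective′ i j i∈ j∈ g′i≡g′j with i ≟ y | j ≟ y
    ... | yes refl | yes refl = refl
    ... | yes refl | no  j≢y  = contradiction (≡-sym g′i≡g′j) (g′-fresh j∈ j≢y)
    ... | no  i≢y  | yes refl = contradiction g′i≡g′j (g′-fresh i∈ i≢y)
    ... | no  i≢y  | no  j≢y  = injective i j (old i∈ i≢y) (old j∈ j≢y)
                                  (trans (≡-sym (g′≡g i≢y)) (trans g′i≡g′j (g′≡g j≢y)))

  NeighboursIn : Subset k → Fin k → Subset k → Set
  NeighboursIn W x Q = ∀ {w} → w ∈ W → Adj H x w → w ∈ Q

  -- Together with a root y as in AlternatingClosure, Q is a Hall obstruction: the |Q| + 1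
  -- vertices y and f⁻¹ Q have all their W-neighbours in Q.
  record AlternatingClosed (U W : Subset k) (f : Fin k → Fin k) (Q : Subset k) : Set where
    field
      saturated : ∀ {u} → u ∈ U → f u ∈ Q → NeighboursIn W u Q
      matched   : ∀ {w} → w ∈ Q → ∃ λ u → u ∈ U × f u ≡ w

  open AlternatingClosed public

  AlternatingClosure : (U W : Subset k) (f : Fin k → Fin k) (y : Fin k) (Q : Subset k) → Set
  AlternatingClosure U W f y Q = AlternatingClosed U W f Q × NeighboursIn W y Q

  ⊥-closed : AlternatingClosed U W f ⊥
  ⊥-closed = record
    { saturated = λ _ fu∈⊥ → contradiction fu∈⊥ ∉⊥
    ; matched   = λ w∈⊥ → contradiction w∈⊥ ∉⊥
    }

  ⋃ᵢ-closed : ∀ {Qs : Fin n → Subset k} →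
              (∀ i → AlternatingClosed U W f (Qs i)) → AlternatingClosed U W f (⋃ᵢ Qs)
  ⋃ᵢ-closed {Qs = Qs} closed = record
    { saturated = λ u∈U fu∈⋃ w∈W u~w →
        let i , fu∈Qᵢ = x∈⋃ᵢ⁻ Qs fu∈⋃ in x∈⋃ᵢ⁺ Qs i (saturated (closed i) u∈U fu∈Qᵢ w∈W u~w)
    ; matched = λ w∈⋃ → let i , w∈Qᵢ = x∈⋃ᵢ⁻ Qs w∈⋃ in matched (closed i) w∈Qᵢ
    }

  closure-lift : IsMatching H U W f → u ∈ U → ∀ {Q} →
                 AlternatingClosure (U - u) (W - f u) f u Q → AlternatingClosed U W f (Q ∪ ⁅ f u ⁆)
  closure-lift {U = U} {W} {f} {u} (_ , injective) u∈U {Q} (Q-closed , u⇝Q) =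
    record { saturated = saturated′ ; matched = matched′ }
    where
    saturated′ : ∀ {u′} → u′ ∈ U → f u′ ∈ Q ∪ ⁅ f u ⁆ → NeighboursIn W u′ (Q ∪ ⁅ f u ⁆)
    saturated′ {u′} u′∈U fu′∈ {w′} w′∈W u′~w′ with w′ ≟ f u | u′ ≟ u
    ... | yes refl  | _        = x∈p∪q⁺ (inj₂ (x∈⁅x⁆ w′))
    ... | no  w′≢fu | yes refl = x∈p∪q⁺ (inj₁ (u⇝Q (x∈p∧x≢y⇒x∈p-y w′∈W w′≢fu) u′~w′))
    ... | no  w′≢fu | no  u′≢u = x∈p∪q⁺ (inj₁
      (saturated Q-closed (x∈p∧x≢y⇒x∈p-y u′∈U u′≢u) fu′∈Q (x∈p∧x≢y⇒x∈p-y w′∈W w′≢fu) u′~w′))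
      where
      fu′∈Q : f u′ ∈ Q
      fu′∈Q = x∈p∪⁅y⁆∧x≢y⇒x∈p fu′∈ (u′≢u ∘ injective u′ u u′∈U u∈U)
    matched′ : ∀ {w} → w ∈ Q ∪ ⁅ f u ⁆ → ∃ λ u′ → u′ ∈ U × f u′ ≡ w
    matched′ {w} w∈ with x∈p∪q⁻ Q ⁅ f u ⁆ w∈
    ... | inj₁ w∈Q   = Product.map₂ (Product.map₁ x∈p-y⇒x∈p) (matched Q-closed w∈Q)
    ... | inj₂ w∈⁅fu⁆ = u , u∈U , ≡-sym (x∈⁅y⁆⇒x≡y (f u) w∈⁅fu⁆)

  -- Induction on |U|: a W-neighbour w of y is either free, or w = f u and the search goes on
  -- from u with U - u and W - w; if every neighbour fails, the closures found are united.
  augment-or-close : IsMatching H U W f → ∀ y →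
                     HasMatchingInto H (U ∪ ⁅ y ⁆) W ⊎ ∃ (AlternatingClosure U W f y)
  augment-or-close {U = U} = bounded (suc ∣ U ∣) ≤-refl
    where
    bounded : ∀ n {U W f} → ∣ U ∣ < n → IsMatching H U W f → ∀ y →
              HasMatchingInto H (U ∪ ⁅ y ⁆) W ⊎ ∃ (AlternatingClosure U W f y)
    bounded (suc n) {U} {W} {f} ∣U∣<1+n f-match y = Sum.map₂ collect (∀⊎⇒⊎∀ branch)
      where
      Branch : Fin k → Subset k → Set
      Branch w B = AlternatingClosed U W f B × (w ∈ W → Adj H y w → w ∈ B)

      collect : (∀ w → ∃ (Branch w)) → ∃ (AlternatingClosure U W f y)
      collect branches =
        ⋃ᵢ (proj₁ ∘ branches) ,
        ⋃ᵢ-closed (proj₁ ∘ proj₂ ∘ branches) ,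
        λ {w} w∈W y~w → x∈⋃ᵢ⁺ (proj₁ ∘ branches) w (proj₂ (proj₂ (branches w)) w∈W y~w)

      branch : ∀ w → HasMatchingInto H (U ∪ ⁅ y ⁆) W ⊎ ∃ (Branch w)
      branch w with w ∈? W ×-dec dec H y w
      ... | no ¬w∈W×y~w = inj₂ (⊥ , ⊥-closed , λ w∈W y~w → contradiction (w∈W , y~w) ¬w∈W×y~w)
      ... | yes (w∈W , y~w) with any? (λ u → u ∈? U ×-dec f u ≟ w)
      ...   | no unmatched = inj₁ (_ , matching-extend (matching-avoid f-match avoids) w∈W y~w)
        where
        avoids : ∀ u → u ∈ U → f u ≢ w
        avoids u u∈U fu≡w = unmatched (u , u∈U , fu≡w)
      ...   | yes (u , u∈U , refl)
            with bounded n (<-≤-trans (x∈p⇒∣p-x∣<∣p∣ u∈U) (≤-pred ∣U∣<1+n))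
                           (matching-remove f-match u∈U) u
      ...     | inj₁ (g , g-match) =
        inj₁ (_ , matching-extend (matching-⊆ p⊆p-x∪⁅x⁆ g-match) w∈W y~w)
      ...     | inj₂ (Q , Q-closure) =
        inj₂ (Q ∪ ⁅ f u ⁆ , closure-lift f-match u∈U Q-closure , λ _ _ → x∈p∪q⁺ (inj₂ (x∈⁅x⁆ (f u))))

  maximal⇒closure : ∀ {X} → IsInclMaximal (Candidate H W X) U → IsMatching H U W f →
                    y ∉ X → y ∉ U → ∃ (AlternatingClosure U W f y)
  maximal⇒closure {W = W} {U = U} {y = y} {X} ((U⊆∁X , _) , U-max) f-match y∉X y∉U =
    [ (λ augmented → contradiction (augmented-is-smaller augmented y∈U∪y) y∉U) , id ]′
      (augment-or-close f-match y)
    where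
    U∪y⊆∁X : U ∪ ⁅ y ⁆ ⊆ ∁ X
    U∪y⊆∁X {z} z∈ with x∈p∪q⁻ U ⁅ y ⁆ z∈
    ... | inj₁ z∈U  = U⊆∁X z∈U
    ... | inj₂ z∈⁅y⁆ rewrite x∈⁅y⁆⇒x≡y y z∈⁅y⁆ = x∉p⇒x∈∁p y∉X
    augmented-is-smaller : HasMatchingInto H (U ∪ ⁅ y ⁆) W → U ∪ ⁅ y ⁆ ⊆ U
    augmented-is-smaller augmented = U-max (U ∪ ⁅ y ⁆) (U∪y⊆∁X , augmented) (p⊆p∪q ⁅ y ⁆)
    y∈U∪y : y ∈ U ∪ ⁅ y ⁆
    y∈U∪y = x∈p∪q⁺ (inj₂ (x∈⁅x⁆ y))

matched-partner∈cover : ∀ {H : Graph k} {S U W C : Subset k} {f : Fin k → Fin k} {u} →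
  IsVertexCover (induced H S) C → IsMatching H U W f → U ⊆ S → W ⊆ S → u ∈ U → f u ∉ C → u ∈ C
matched-partner∈cover C-cover (maps , _) U⊆S W⊆S u∈U fu∉C
  with C-cover _ _ (proj₂ (maps _ u∈U) , U⊆S u∈U , W⊆S (proj₁ (maps _ u∈U)))
... | inj₁ u∈C  = u∈C
... | inj₂ fu∈C = contradiction fu∈C fu∉C

module Exchange {k} {H : Graph k} {S W U Q : Subset k} {f : Fin k → Fin k}
  (W-cover : IsVertexCover H W) (U⊆∁W : U ⊆ ∁ W) (W⊆S : W ⊆ S) (U⊆S : U ⊆ S)
  (f-match : IsMatching H U W f) (Q-closed : AlternatingClosed H U W f Q)
  {C : Subset k} (C-cover : IsVertexCover (induced H S) C) where

  exchange : Subset k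
  exchange = (C ─ (U ∩ preimage f Q)) ∪ Q

  Q⊆W : Q ⊆ W
  Q⊆W w∈Q with matched Q-closed w∈Q
  ... | u , u∈U , refl = proj₁ (proj₁ f-match u u∈U)

  Q⊆exchange : Q ⊆ exchange
  Q⊆exchange = q⊆p∪q _ Q

  ∈exchange⁺ : x ∈ C → ¬ (x ∈ U × f x ∈ Q) → x ∈ exchange
  ∈exchange⁺ x∈C ¬dropped = x∈p∪q⁺ (inj₁ (x∈p∧x∉q⇒x∈p─q x∈C
    (¬dropped ∘ Product.map₂ x∈preimage⁻ ∘ x∈p∩q⁻ U (preimage f Q))))

  ∈exchange∧∉C⇒∈Q : x ∈ exchange → x ∉ C → x ∈ Q
  ∈exchange∧∉C⇒∈Q x∈ x∉C with x∈p∪q⁻ (C ─ (U ∩ preimage f Q)) Q x∈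
  ... | inj₁ x∈C─ = contradiction (p─q⊆p C _ x∈C─) x∉C
  ... | inj₂ x∈Q  = x∈Q

  dropped∉exchange : x ∈ U → f x ∈ Q → x ∉ exchange
  dropped∉exchange x∈U fx∈Q x∈ with x∈p∪q⁻ (C ─ (U ∩ preimage f Q)) Q x∈
  ... | inj₁ x∈C─ = x∈p─q⇒x∉q C _ x∈C─ (x∈p∩q⁺ (x∈U , x∈preimage⁺ fx∈Q))
  ... | inj₂ x∈Q  = x∈∁p⇒x∉p (U⊆∁W x∈U) (Q⊆W x∈Q)

  exchange-cover : IsVertexCover (induced H S) exchange
  exchange-cover i j i~j@(adj , _) = [ keep adj , swap ∘ keep (sym H adj) ]′ (C-cover i j i~j)
    where
    keep : ∀ {i j} → Adj H i j → i ∈ C → i ∈ exchange ⊎ j ∈ exchange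
    keep {i} {j} i~j i∈C with i ∈? U ×-dec f i ∈? Q
    ... | no  ¬dropped     = inj₁ (∈exchange⁺ i∈C ¬dropped)
    ... | yes (i∈U , fi∈Q) = inj₂ (Q⊆exchange (saturated Q-closed i∈U fi∈Q j∈W i~j))
      where
      j∈W : j ∈ W
      j∈W with W-cover i j i~j
      ... | inj₁ i∈W = contradiction i∈W (x∈∁p⇒x∉p (U⊆∁W i∈U))
      ... | inj₂ j∈W = j∈W

  -- A vertex already in C is its own partner; a new vertex z ∈ Q is paired with its
  -- f-preimage, which C contains in order to cover their edge.
  Partner : Fin k → Fin k → Set
  Partner z y = (z ∈ C × y ≡ z) ⊎ (z ∉ C × y ∈ U × f y ≡ z)

  partner-injects : Injects Partner exchange C
  partner-injects = total , injective
    where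
    total : ∀ {z} → z ∈ exchange → ∃ λ y → y ∈ C × Partner z y
    total {z} z∈ with z ∈? C
    ... | yes z∈C = z , z∈C , inj₁ (z∈C , refl)
    ... | no  z∉C with matched Q-closed (∈exchange∧∉C⇒∈Q z∈ z∉C)
    ...   | u , u∈U , refl =
      u , matched-partner∈cover {H = H} C-cover f-match U⊆S W⊆S u∈U z∉C , inj₂ (z∉C , u∈U , refl)
    injective : ∀ {z z′ y} → z ∈ exchange → z′ ∈ exchange → Partner z y → Partner z′ y → z ≡ z′
    injective _  _   (inj₁ (_ , refl))          (inj₁ (_ , refl))          = refl
    injective _  _   (inj₂ (_ , _ , refl))      (inj₂ (_ , _ , refl))      = refl
    injective z∈ z′∈ (inj₁ (_ , refl))          (inj₂ (z′∉C , y∈U , refl)) =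
      contradiction z∈ (dropped∉exchange y∈U (∈exchange∧∉C⇒∈Q z′∈ z′∉C))
    injective z∈ z′∈ (inj₂ (z∉C , y∈U , refl)) (inj₁ (_ , refl))          =
      contradiction z′∈ (dropped∉exchange y∈U (∈exchange∧∉C⇒∈Q z∈ z∉C))

  exchange-≤ : ∣ exchange ∣ ≤ ∣ C ∣
  exchange-≤ = injects⇒∣p∣≤∣q∣ partner-injects

  exchange-< : ∀ {u} → u ∈ U → f u ∈ Q → f u ∈ C → u ∈ C → ∣ exchange ∣ < ∣ C ∣
  exchange-< {u} u∈U fu∈Q fu∈C u∈C = injects-avoiding⇒∣p∣<∣q∣ partner-injects u∈C unpartnered
    where
    unpartnered : ∀ {z} → z ∈ exchange → ¬ Partner z u
    unpartnered z∈ (inj₁ (_ , refl))       = dropped∉exchange u∈U fu∈Q z∈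
    unpartnered _  (inj₂ (z∉C , _ , refl)) = z∉C fu∈C

module _ {k} {H : Graph k} {W U₁ U₂ C : Subset k} {f₁ f₂ : Fin k → Fin k}
  (W-cover : IsVertexCover H W)
  (U₁-max : IsInclMaximal (Candidate H W W) U₁) (f₁-match : IsMatching H U₁ W f₁)
  (U₂-max : IsInclMaximal (Candidate H W (W ∪ U₁)) U₂) (f₂-match : IsMatching H U₂ W f₂)
  (C-min : IsMinVertexCover (induced H (W ∪ U₁ ∪ U₂)) C) where

  private
    S : Subset k
    S = W ∪ U₁ ∪ U₂

    W⊆S : W ⊆ S
    W⊆S = p⊆p∪q (U₁ ∪ U₂)

    U₁⊆S : U₁ ⊆ S
    U₁⊆S = q⊆p∪q W (U₁ ∪ U₂) ∘ p⊆p∪q U₂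

    U₂⊆S : U₂ ⊆ S
    U₂⊆S = q⊆p∪q W (U₁ ∪ U₂) ∘ q⊆p∪q U₁ U₂

    U₁⊆∁W : U₁ ⊆ ∁ W
    U₁⊆∁W = proj₁ (proj₁ U₁-max)

    U₂⊆∁W : U₂ ⊆ ∁ W
    U₂⊆∁W x∈U₂ = x∉p⇒x∈∁p (x∈∁p⇒x∉p (proj₁ (proj₁ U₂-max) x∈U₂) ∘ p⊆p∪q U₁)

    U₂∩U₁=∅ : ∀ {x} → x ∈ U₂ → x ∉ U₁
    U₂∩U₁=∅ x∈U₂ = x∈∁p⇒x∉p (proj₁ (proj₁ U₂-max) x∈U₂) ∘ q⊆p∪q W U₁

    C-cover : IsVertexCover (induced H S) C
    C-cover = proj₁ C-min

  smaller-cover : ∀ {a v} → a ∈ W → Adj H a v → v ∉ S → a ∉ C →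
                  ∃ λ C′ → IsVertexCover (induced H S) C′ × ∣ C′ ∣ < ∣ C ∣
  smaller-cover {a} {v} a∈W a~v v∉S a∉C
    with maximal⇒closure H U₁-max f₁-match (v∉S ∘ W⊆S) (v∉S ∘ U₁⊆S)
       | maximal⇒closure H U₂-max f₂-match ([ v∉S ∘ W⊆S , v∉S ∘ U₁⊆S ]′ ∘ x∈p∪q⁻ W U₁) (v∉S ∘ U₂⊆S)
  ... | Q₁ , Q₁-closed , v⇝Q₁ | Q₂ , Q₂-closed , v⇝Q₂
    with matched Q₂-closed (v⇝Q₂ a∈W (sym H a~v))
  ... | p , p∈U₂ , refl = E₂.exchange , E₂.exchange-cover , (begin-strict
      ∣ E₂.exchange ∣ <⟨ E₂.exchange-< p∈U₂ (v⇝Q₂ a∈W (sym H a~v)) fp∈C₁ p∈C₁ ⟩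
      ∣ E₁.exchange ∣ ≤⟨ E₁.exchange-≤ ⟩
      ∣ C ∣           ∎)
    where
    open ≤-Reasoning
    module E₁ = Exchange W-cover U₁⊆∁W W⊆S U₁⊆S f₁-match Q₁-closed C-cover
    module E₂ = Exchange W-cover U₂⊆∁W W⊆S U₂⊆S f₂-match Q₂-closed E₁.exchange-cover
    fp∈C₁ : f₂ p ∈ E₁.exchange
    fp∈C₁ = E₁.Q⊆exchange (v⇝Q₁ a∈W (sym H a~v))
    p∈C₁ : p ∈ E₁.exchange
    p∈C₁ = E₁.∈exchange⁺ (matched-partner∈cover {H = H} C-cover f₂-match U₂⊆S W⊆S p∈U₂ a∉C)
                         (U₂∩U₁=∅ p∈U₂ ∘ proj₁)

  outer-neighbour⇒∈C : ∀ {a v} → a ∈ W → Adj H a v → v ∉ S → a ∈ C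
  outer-neighbour⇒∈C a∈W a~v v∉S = decidable-stable (_ ∈? C) λ a∉C →
    let C′ , C′-cover , ∣C′∣<∣C∣ = smaller-cover a∈W a~v v∉S a∉C
    in <⇒≱ ∣C′∣<∣C∣ (proj₂ C-min C′ C′-cover)

  edges-at-W-covered : ∀ {a v} → a ∈ W → Adj H a v → a ∈ C ⊎ v ∈ C
  edges-at-W-covered {a} {v} a∈W a~v with v ∈? S
  ... | yes v∈S = C-cover a v (a~v , W⊆S a∈W , v∈S)
  ... | no  v∉S = inj₁ (outer-neighbour⇒∈C a∈W a~v v∉S)

corollary4p8 : (k : ℕ) (H : Graph k) (W U₁ U₂ : Subset k) →
    IsLexFirst (IsMinVertexCover H) W →
    IsLexFirst (IsInclMaximal (Candidate H W W)) U₁ →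
    IsLexFirst (IsInclMaximal (Candidate H W (W ∪ U₁))) U₂ →
    ∀ C → IsMinVertexCover (induced H (W ∪ U₁ ∪ U₂)) C → IsVertexCover H C
corollary4p8 k H W U₁ U₂ ((W-cover , _) , _)
  (U₁-max@((_ , _ , f₁-match) , _) , _) (U₂-max@((_ , _ , f₂-match) , _) , _) C C-min i j i~j =
  [ (λ i∈W → covered i∈W i~j) , (λ j∈W → swap (covered j∈W (sym H i~j))) ]′ (W-cover i j i~j)
  where
  covered : ∀ {a v} → a ∈ W → Adj H a v → a ∈ C ⊎ v ∈ C
  covered = edges-at-W-covered {H = H} W-cover U₁-max f₁-match U₂-max f₂-match C-min
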